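{- Let $q$ be a power of a prime $p\geq5$ and let $\xi$ be a generator of $\mathbb{F}_q^*$. Let $\Omega_3(\mathbb{F}_q)\subset\mathrm{GL}_3(\mathbb{F}_q)$ be the subgroup generated by $\begin{pmatrix}1&2&-1\\-1&-1&0\\-1&0&0\end{pmatrix}$ and $\begin{pmatrix}\xi^{ -2}&0&0\\0&1&0\\0&0&\xi^2\end{pmatrix}$. Then $\Omega_3(\mathbb{F}_q)$ acts irreducibly on $\mathbb{F}_q^3$. -}

module Defs where

open import Level using (Level; _⊔_; Setω)
open import Data.Nat using (ℕ; zero; suc)
open import Data.Fin using (Fin; zero; suc)
open import Data.Product using (Σ; ∃; _×_; _,_)
open import Relation.Nullary using (¬_)
open import Algebra.Bundles using (CommutativeRing)

record IsField {c ℓ : Level} (R : CommutativeRing c ℓ) : Set (c ⊔ ℓ) where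
  open CommutativeRing R
  field
    0≉1 : ¬ (0# ≈ 1#)
    inverse : ∀ x → ¬ (x ≈ 0#) → ∃ λ y → x * y ≈ 1#

module Linear {c ℓ : Level} (R : CommutativeRing c ℓ) where
  open CommutativeRing R hiding (zero)

  _^_ : Carrier → ℕ → Carrier
  x ^ zero = 1#
  x ^ suc n = x * (x ^ n)

  IsGenerator : Carrier → Set (c ⊔ ℓ)
  IsGenerator ξ = ¬ (ξ ≈ 0#) × (∀ x → ¬ (x ≈ 0#) → ∃ λ n → x ≈ ξ ^ n)

  Vec3 : Set c
  Vec3 = Fin 3 → Carrier

  Mat3 : Set c
  Mat3 = Fin 3 → Fin 3 → Carrier

  sum3 : (Fin 3 → Carrier) → Carrier
  sum3 f = f zero + (f (suc zero) + f (suc (suc zero)))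

  _·_ : Mat3 → Mat3 → Mat3
  (M · N) i j = sum3 (λ k → M i k * N k j)

  _⊛_ : Mat3 → Vec3 → Vec3
  (M ⊛ v) i = sum3 (λ k → M i k * v k)

  I₃ : Mat3
  I₃ zero zero = 1#
  I₃ (suc zero) (suc zero) = 1#
  I₃ (suc (suc zero)) (suc (suc zero)) = 1#
  I₃ _ _ = 0#

  _≈M_ : Mat3 → Mat3 → Set ℓ
  M ≈M N = ∀ i j → M i j ≈ N i j

  _≈V_ : Vec3 → Vec3 → Set ℓ
  u ≈V v = ∀ i → u i ≈ v i

  0V : Vec3
  0V _ = 0#

  -- the subgroup of GL_3 generated by two invertible matrices A and B:
  -- smallest set containing I and closed under left multiplication by
  -- A, B, and by their inverses (any N with N·A ≈ I, resp. N·B ≈ I).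
  data Generated (A B : Mat3) : Mat3 → Set (c ⊔ ℓ) where
    gen-id   : Generated A B I₃
    gen-A    : ∀ {g} → Generated A B g → Generated A B (A · g)
    gen-B    : ∀ {g} → Generated A B g → Generated A B (B · g)
    gen-A⁻¹  : ∀ {g N} → (N · A) ≈M I₃ → Generated A B g → Generated A B (N · g)
    gen-B⁻¹  : ∀ {g N} → (N · B) ≈M I₃ → Generated A B g → Generated A B (N · g)

  record IsSubspace {w : Level} (W : Vec3 → Set w) : Set (c ⊔ ℓ ⊔ w) where
    field
      resp  : ∀ {u v} → u ≈V v → W u → W v
      zero∈ : W 0V
      +∈    : ∀ {u v} → W u → W v → W (λ i → u i + v i)
      *∈    : ∀ a {u} → W u → W (λ i → a * u i)

  ActsIrreducibly : (Mat3 → Set (c ⊔ ℓ)) → Setω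
  ActsIrreducibly G = ∀ {w : Level} (W : Vec3 → Set w) → IsSubspace W →
    (∀ g v → G g → W v → W (g ⊛ v)) →
    ∀ v → W v → ¬ (v ≈V 0V) → ∀ u → W u

  -- the two generators of Ω₃(F_q); η stands for ξ⁻¹
  ΩA : Mat3
  ΩA zero zero = 1#
  ΩA zero (suc zero) = 1# + 1#
  ΩA zero (suc (suc zero)) = - 1#
  ΩA (suc zero) zero = - 1#
  ΩA (suc zero) (suc zero) = - 1#
  ΩA (suc zero) (suc (suc zero)) = 0#
  ΩA (suc (suc zero)) zero = - 1#
  ΩA (suc (suc zero)) (suc zero) = 0#
  ΩA (suc (suc zero)) (suc (suc zero)) = 0#

  ΩB : Carrier → Carrier → Mat3
  ΩB ξ η zero zero = η * η
  ΩB ξ η (suc zero) (suc zero) = 1#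
  ΩB ξ η (suc (suc zero)) (suc (suc zero)) = ξ * ξ
  ΩB ξ η _ _ = 0#

{-# OPTIONS --safe #-}
-- ΩB ξ η is diagonal with entries ξ⁻², 1, ξ², and ξ² ≉ 1 because F* has at
-- least four elements. Products of the shifts ΩB − t kill all but one
-- eigenvalue, so a nonzero invariant subspace contains a standard basis
-- vector (when ξ⁻² ≈ ξ² it is the middle one, possibly after one application
-- of ΩA). ΩA then carries that basis vector to the other two; for e₂ this
-- needs 1 + 1 ≉ 0, which holds because F has odd order: otherwise x ↦ x + 1
-- would be a fixed-point-free involution of F.
module Submission where

open import Defs
open import Level using (Level)
open import Data.Nat using (ℕ; _≤_; _^_)
open import Data.Nat.Primality using (Prime)
open import Data.Fin using (Fin)
open import Algebra.Bundles using (CommutativeRing)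
open import Function.Bundles using (Inverse)
open import Relation.Binary.PropositionalEquality using (setoid)

open import Data.Nat as ℕ using (zero; suc; s≤s; z≤n)
import Data.Nat.Properties as ℕ
open import Data.Nat.Divisibility using (_∣_; _∣0; ∣1⇒≡1; ∣-refl; ∣m∣n⇒∣m+n)
open import Data.Nat.Primality using (prime[2]; ¬prime[1]; euclidsLemma; prime⇒irreducible)
open import Data.Integer as ℤ using (ℤ; +_; -[1+_]; _⊖_; sign; ∣_∣; _◃_)
import Data.Integer.Properties as ℤ
open import Data.Sign as Sign using (Sign)
open import Data.Fin as Fin using (zero; suc; punchIn; punchOut)
import Data.Fin.Properties as Fin
open import Data.Maybe using (Maybe; just; nothing)
open import Data.Product using (∃; _,_; proj₁; proj₂)
open import Data.Sum using (_⊎_; inj₁; inj₂)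
open import Data.Empty using (⊥-elim)
open import Function using (_∘_)
open import Function.Definitions using (Injective)
open import Function.Properties.Inverse using (Inverse⇒Injection)
open import Relation.Nullary using (¬_; yes; no)
open import Relation.Nullary.Decidable using (via-injection)
open import Relation.Binary.Bundles using (Setoid)
open import Relation.Binary.Definitions using (Decidable)
open import Relation.Binary.PropositionalEquality as ≡ using (_≡_; _≢_)
open import Algebra.Solver.Ring.AlmostCommutativeRing
  using (_-Raw-AlmostCommutative⟶_; fromCommutativeRing)
import Algebra.Solver.Ring as RingSolver
import Algebra.Properties.Ring as RingProperties
import Algebra.Properties.Semiring.Mult.TCOptimised as Multiples
import Algebra.Properties.CommutativeSemigroup as CommutativeSemigroupProperties
import Relation.Binary.Reasoning.Setoid as SetoidReasoning

-- The ring solver needs coefficients with decidable equality; ℤ, mapped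
-- canonically into R, serves every commutative ring.
module IntegerCoefficients {c ℓ : Level} (R : CommutativeRing c ℓ) where
  open CommutativeRing R
  open RingProperties ring
    using (-0#≈0#; -‿involutive; -‿+-comm; -‿distribˡ-*; -‿distribʳ-*)
  open CommutativeSemigroupProperties +-commutativeSemigroup using (interchange)
  open SetoidReasoning (CommutativeRing.setoid R)

  -- The optimised _×_ has 1 × x = x, so the solver's constant 1 is 1#
  -- definitionally and solver goals match the ring's own literals.
  open Multiples semiring using (_×_; 1+×; ×-homo-+; ×1-homo-*)

  ⟦_⟧ : ℤ → Carrier
  ⟦ + n ⟧      = n × 1#
  ⟦ -[1+ n ] ⟧ = - (suc n × 1#)

  [1+x]-[1+y]≈x-y : ∀ x y → (1# + x) - (1# + y) ≈ x - y
  [1+x]-[1+y]≈x-y x y = begin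
    (1# + x) + - (1# + y)    ≈⟨ +-congˡ (-‿+-comm 1# y) ⟨
    (1# + x) + (- 1# + - y)  ≈⟨ interchange 1# x (- 1#) (- y) ⟩
    (1# + - 1#) + (x + - y)  ≈⟨ +-congʳ (-‿inverseʳ 1#) ⟩
    0# + (x + - y)           ≈⟨ +-identityˡ _ ⟩
    x + - y                  ∎

  ⟦⟧-⊖ : ∀ m n → ⟦ m ⊖ n ⟧ ≈ m × 1# - n × 1#
  ⟦⟧-⊖ zero    zero    = sym (trans (+-identityˡ _) -0#≈0#)
  ⟦⟧-⊖ zero    (suc n) = sym (+-identityˡ _)
  ⟦⟧-⊖ (suc m) zero    = sym (trans (+-congˡ -0#≈0#) (+-identityʳ _))
  ⟦⟧-⊖ (suc m) (suc n) rewrite ℤ.[1+m]⊖[1+n]≡m⊖n m n = begin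
    ⟦ m ⊖ n ⟧                      ≈⟨ ⟦⟧-⊖ m n ⟩
    m × 1# - n × 1#                ≈⟨ [1+x]-[1+y]≈x-y _ _ ⟨
    (1# + m × 1#) - (1# + n × 1#)  ≈⟨ +-cong (1+× m 1#) (-‿cong (1+× n 1#)) ⟨
    suc m × 1# - suc n × 1#        ∎

  ⟦⟧-+ : ∀ i j → ⟦ i ℤ.+ j ⟧ ≈ ⟦ i ⟧ + ⟦ j ⟧
  ⟦⟧-+ (+ m)    (+ n)    = ×-homo-+ 1# m n
  ⟦⟧-+ (+ m)    -[1+ n ] = ⟦⟧-⊖ m (suc n)
  ⟦⟧-+ -[1+ m ] (+ n)    = trans (⟦⟧-⊖ n (suc m)) (+-comm _ _)
  ⟦⟧-+ -[1+ m ] -[1+ n ] = begin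
    - (suc (suc (m ℕ.+ n)) × 1#)     ≡⟨ ≡.cong (λ k → - (k × 1#)) (ℕ.+-suc (suc m) n) ⟨
    - ((suc m ℕ.+ suc n) × 1#)       ≈⟨ -‿cong (×-homo-+ 1# (suc m) (suc n)) ⟩
    - (suc m × 1# + suc n × 1#)      ≈⟨ -‿+-comm _ _ ⟨
    - (suc m × 1#) + - (suc n × 1#)  ∎

  ⟦⟧-neg : ∀ i → ⟦ ℤ.- i ⟧ ≈ - ⟦ i ⟧
  ⟦⟧-neg (+ zero)  = sym -0#≈0#
  ⟦⟧-neg (+ suc n) = refl
  ⟦⟧-neg -[1+ n ]  = sym (-‿involutive _)

  signed : Sign → Carrier → Carrier
  signed Sign.+ x = x
  signed Sign.- x = - x

  signed-cong : ∀ s {x y} → x ≈ y → signed s x ≈ signed s y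
  signed-cong Sign.+ x≈y = x≈y
  signed-cong Sign.- x≈y = -‿cong x≈y

  ⟦⟧-◃ : ∀ s n → ⟦ s ◃ n ⟧ ≈ signed s (n × 1#)
  ⟦⟧-◃ Sign.+ zero    = refl
  ⟦⟧-◃ Sign.- zero    = sym -0#≈0#
  ⟦⟧-◃ Sign.+ (suc n) = refl
  ⟦⟧-◃ Sign.- (suc n) = refl

  ⟦⟧≡signed : ∀ i → ⟦ i ⟧ ≡ signed (sign i) (∣ i ∣ × 1#)
  ⟦⟧≡signed (+ n)    = ≡.refl
  ⟦⟧≡signed -[1+ n ] = ≡.refl

  signed-* : ∀ s t x y → signed (s Sign.* t) (x * y) ≈ signed s x * signed t y
  signed-* Sign.+ Sign.+ x y = refl
  signed-* Sign.+ Sign.- x y = -‿distribʳ-* x y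
  signed-* Sign.- Sign.+ x y = -‿distribˡ-* x y
  signed-* Sign.- Sign.- x y = begin
    x * y        ≈⟨ -‿involutive _ ⟨
    - - (x * y)  ≈⟨ -‿cong (-‿distribʳ-* x y) ⟩
    - (x * - y)  ≈⟨ -‿distribˡ-* x (- y) ⟩
    - x * - y    ∎

  ⟦⟧-* : ∀ i j → ⟦ i ℤ.* j ⟧ ≈ ⟦ i ⟧ * ⟦ j ⟧
  ⟦⟧-* i j = begin
    ⟦ s ◃ (∣ i ∣ ℕ.* ∣ j ∣) ⟧
      ≈⟨ ⟦⟧-◃ s (∣ i ∣ ℕ.* ∣ j ∣) ⟩
    signed s ((∣ i ∣ ℕ.* ∣ j ∣) × 1#)
      ≈⟨ signed-cong s (×1-homo-* ∣ i ∣ ∣ j ∣) ⟩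
    signed s (∣ i ∣ × 1# * ∣ j ∣ × 1#)
      ≈⟨ signed-* (sign i) (sign j) _ _ ⟩
    signed (sign i) (∣ i ∣ × 1#) * signed (sign j) (∣ j ∣ × 1#)
      ≡⟨ ≡.cong₂ _*_ (⟦⟧≡signed i) (⟦⟧≡signed j) ⟨
    ⟦ i ⟧ * ⟦ j ⟧
      ∎
    where s = sign i Sign.* sign j

  ℤ-homomorphism : ℤ.+-*-rawRing -Raw-AlmostCommutative⟶ fromCommutativeRing R
  ℤ-homomorphism = record
    { ⟦_⟧    = ⟦_⟧
    ; +-homo = ⟦⟧-+
    ; *-homo = ⟦⟧-*
    ; -‿homo = ⟦⟧-neg
    ; 0-homo = refl
    ; 1-homo = refl
    }

  ⟦⟧-≟ : ∀ i j → Maybe (⟦ i ⟧ ≈ ⟦ j ⟧)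
  ⟦⟧-≟ i j with i ℤ.≟ j
  ... | yes ≡.refl = just refl
  ... | no _       = nothing

  open RingSolver ℤ.+-*-rawRing (fromCommutativeRing R) ℤ-homomorphism ⟦⟧-≟ public
    using (solve; _:=_; con; Polynomial; _:+_; _:*_; _:-_; :-_)

  :0 :1 :2 : ∀ {k} → Polynomial k
  :0 = con (+ 0)
  :1 = con (+ 1)
  :2 = :1 :+ :1

module _ {a ℓ : Level} {S : Setoid a ℓ} {n : ℕ} (I : Inverse S (setoid (Fin n))) where
  open Setoid S
  open Inverse I

  covering⇒≤ : ∀ {m} (rep : Fin m → Carrier) → (∀ x → ∃ λ i → x ≈ rep i) → n ≤ m
  covering⇒≤ {m} rep cover = Fin.injective⇒≤ index-injective
    where
    index : Fin n → Fin m
    index i = proj₁ (cover (from i))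

    index-injective : Injective _≡_ _≡_ index
    index-injective {i} {j} index-i≡index-j = begin
      i            ≡⟨ strictlyInverseˡ i ⟨
      to (from i)  ≡⟨ to-cong from-i≈from-j ⟩
      to (from j)  ≡⟨ strictlyInverseˡ j ⟩
      j            ∎
      where
      open ≡.≡-Reasoning
      from-i≈from-j : from i ≈ from j
      from-i≈from-j = trans (proj₂ (cover (from i)))
        (trans (reflexive (≡.cong rep index-i≡index-j)) (sym (proj₂ (cover (from j)))))

-- The restriction of τ to the complement of its orbit {zero, suc j},
-- identified with Fin m through embed.
module WithoutOrbit {m : ℕ} (τ : Fin (suc (suc m)) → Fin (suc (suc m)))
  (τ-involutive : ∀ i → τ (τ i) ≡ i) (τ-fixedPointFree : ∀ i → τ i ≢ i)
  (j : Fin (suc m)) (τ0≡1+j : τ zero ≡ suc j) where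

  embed : Fin m → Fin (suc (suc m))
  embed i = suc (punchIn j i)

  unembed : (x : Fin (suc (suc m))) → x ≢ zero → x ≢ suc j → Fin m
  unembed zero    x≢0 _     = ⊥-elim (x≢0 ≡.refl)
  unembed (suc k) _   x≢1+j =
    punchOut {i = j} {j = k} (λ j≡k → x≢1+j (≡.cong suc (≡.sym j≡k)))

  embed-unembed : ∀ x x≢0 x≢1+j → embed (unembed x x≢0 x≢1+j) ≡ x
  embed-unembed zero    x≢0 _ = ⊥-elim (x≢0 ≡.refl)
  embed-unembed (suc k) _   _ = ≡.cong suc (Fin.punchIn-punchOut _)

  unembed-embed : ∀ x x≢0 x≢1+j i → embed i ≡ x → unembed x x≢0 x≢1+j ≡ i
  unembed-embed x x≢0 x≢1+j i embed-i≡x = Fin.punchIn-injective j _ _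
    (Fin.suc-injective (≡.trans (embed-unembed x x≢0 x≢1+j) (≡.sym embed-i≡x)))

  τ-embed≢0 : ∀ i → τ (embed i) ≢ zero
  τ-embed≢0 i eq = Fin.punchInᵢ≢i j i (Fin.suc-injective
    (≡.trans (≡.sym (τ-involutive (embed i))) (≡.trans (≡.cong τ eq) τ0≡1+j)))

  τ-embed≢1+j : ∀ i → τ (embed i) ≢ suc j
  τ-embed≢1+j i eq
    with () ← ≡.trans (≡.sym (τ-involutive (embed i)))
                (≡.trans (≡.cong τ (≡.trans eq (≡.sym τ0≡1+j))) (τ-involutive zero))

  restrict : Fin m → Fin m
  restrict i = unembed (τ (embed i)) (τ-embed≢0 i) (τ-embed≢1+j i)

  embed-restrict : ∀ i → embed (restrict i) ≡ τ (embed i)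
  embed-restrict i = embed-unembed _ (τ-embed≢0 i) (τ-embed≢1+j i)

  restrict-involutive : ∀ i → restrict (restrict i) ≡ i
  restrict-involutive i = unembed-embed _ _ _ i
    (≡.sym (≡.trans (≡.cong τ (embed-restrict i)) (τ-involutive (embed i))))

  restrict-fixedPointFree : ∀ i → restrict i ≢ i
  restrict-fixedPointFree i eq =
    τ-fixedPointFree (embed i) (≡.trans (≡.sym (embed-restrict i)) (≡.cong embed eq))

fixedPointFree-involution⇒even : ∀ n (τ : Fin n → Fin n) →
  (∀ i → τ (τ i) ≡ i) → (∀ i → τ i ≢ i) → 2 ∣ n
fixedPointFree-involution⇒even zero τ _ _ = 2 ∣0
fixedPointFree-involution⇒even (suc zero) τ _ τ-fpf with τ zero in eq
... | zero = ⊥-elim (τ-fpf zero eq)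
fixedPointFree-involution⇒even (suc (suc m)) τ τ-inv τ-fpf with τ zero in eq
... | zero  = ⊥-elim (τ-fpf zero eq)
... | suc j = ∣m∣n⇒∣m+n ∣-refl
  (fixedPointFree-involution⇒even m restrict restrict-involutive restrict-fixedPointFree)
  where open WithoutOrbit τ τ-inv τ-fpf j eq

prime∤⇒prime∤^ : ∀ {q m} → Prime q → ¬ q ∣ m → ∀ k → ¬ q ∣ m ^ k
prime∤⇒prime∤^ q-prime q∤m zero q∣1 = ¬prime[1] (≡.subst Prime (∣1⇒≡1 q∣1) q-prime)
prime∤⇒prime∤^ {m = m} q-prime q∤m (suc k) q∣m*m^k
  with euclidsLemma m (m ^ k) q-prime q∣m*m^k
... | inj₁ q∣m   = q∤m q∣m
... | inj₂ q∣m^k = prime∤⇒prime∤^ q-prime q∤m k q∣m^k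

2∤odd-prime : ∀ {p} → Prime p → 3 ≤ p → ¬ 2 ∣ p
2∤odd-prime p-prime 3≤p 2∣p with prime⇒irreducible p-prime 2∣p
... | inj₁ ()
... | inj₂ ≡.refl = ℕ.<-irrefl ≡.refl 3≤p

m≤m^n : ∀ m n → 1 ≤ m → 1 ≤ n → m ≤ m ^ n
m≤m^n m (suc n) 1≤m _ = ℕ.m≤m*n m (m ^ n) {{ℕ.m^n≢0 m n {{ℕ.>-nonZero 1≤m}}}}

module FiniteField {c ℓ : Level} (F : CommutativeRing c ℓ) {n : ℕ}
  (I : Inverse (CommutativeRing.setoid F) (setoid (Fin n))) where
  open CommutativeRing F hiding (zero; setoid)
  open RingProperties ring using (+-cancelˡ)
  open Linear F using (IsGenerator) renaming (_^_ to _^ᶠ_)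
  open Inverse I
  open SetoidReasoning (CommutativeRing.setoid F)

  _≟_ : Decidable _≈_
  _≟_ = via-injection (Inverse⇒Injection I) Fin._≟_

  1+1≈0⇒even : ¬ 0# ≈ 1# → 1# + 1# ≈ 0# → 2 ∣ n
  1+1≈0⇒even 0≉1 1+1≈0 =
    fixedPointFree-involution⇒even n successor successor-involutive successor-fixedPointFree
    where
    successor : Fin n → Fin n
    successor i = to (from i + 1#)

    successor-involutive : ∀ i → successor (successor i) ≡ i
    successor-involutive i = ≡.trans (to-cong (begin
      from (to (from i + 1#)) + 1#  ≈⟨ +-congʳ (strictlyInverseʳ _) ⟩
      (from i + 1#) + 1#            ≈⟨ +-assoc _ _ _ ⟩
      from i + (1# + 1#)            ≈⟨ +-congˡ 1+1≈0 ⟩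
      from i + 0#                   ≈⟨ +-identityʳ _ ⟩
      from i                        ∎)) (strictlyInverseˡ i)

    successor-fixedPointFree : ∀ i → successor i ≢ i
    successor-fixedPointFree i eq = 0≉1 (sym (+-cancelˡ (from i) 1# 0# (begin
      from i + 1#              ≈⟨ strictlyInverseʳ _ ⟨
      from (to (from i + 1#))  ≈⟨ from-cong eq ⟩
      from i                   ≈⟨ +-identityʳ _ ⟨
      from i + 0#              ∎)))

  generator²≉1 : 4 ≤ n → ∀ ξ → IsGenerator ξ → ¬ ξ * ξ ≈ 1#
  generator²≉1 4≤n ξ (_ , generates) ξ²≈1 =
    ℕ.<-irrefl ≡.refl (ℕ.≤-trans 4≤n (covering⇒≤ I element cover))
    where
    power-of-ξ : ∀ k → ξ ^ᶠ k ≈ 1# ⊎ ξ ^ᶠ k ≈ ξ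
    power-of-ξ zero = inj₁ refl
    power-of-ξ (suc k) with power-of-ξ k
    ... | inj₁ ξᵏ≈1 = inj₂ (trans (*-congˡ ξᵏ≈1) (*-identityʳ ξ))
    ... | inj₂ ξᵏ≈ξ = inj₁ (trans (*-congˡ ξᵏ≈ξ) ξ²≈1)

    element : Fin 3 → Carrier
    element zero             = 0#
    element (suc zero)       = 1#
    element (suc (suc zero)) = ξ

    cover : ∀ x → ∃ λ i → x ≈ element i
    cover x with x ≟ 0#
    ... | yes x≈0 = zero , x≈0
    ... | no x≉0 with generates x x≉0
    ... | k , x≈ξᵏ with power-of-ξ k
    ... | inj₁ ξᵏ≈1 = suc zero , trans x≈ξᵏ ξᵏ≈1
    ... | inj₂ ξᵏ≈ξ = suc (suc zero) , trans x≈ξᵏ ξᵏ≈ξ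

module FieldProperties {c ℓ : Level} (F : CommutativeRing c ℓ) (isField : IsField F) where
  open CommutativeRing F
  open IsField isField
  open RingProperties ring using (x∙y⁻¹≈ε⇒x≈y; -‿involutive; -0#≈0#)
  open IntegerCoefficients F
  open SetoidReasoning (CommutativeRing.setoid F)

  *-nonzero : ∀ {x y} → ¬ x ≈ 0# → ¬ y ≈ 0# → ¬ x * y ≈ 0#
  *-nonzero {x} {y} x≉0 y≉0 xy≈0 with inverse x x≉0
  ... | x⁻¹ , xx⁻¹≈1 = y≉0 (begin
    y              ≈⟨ *-identityˡ y ⟨
    1# * y         ≈⟨ *-congʳ (trans (sym xx⁻¹≈1) (*-comm x x⁻¹)) ⟩
    (x⁻¹ * x) * y  ≈⟨ *-assoc x⁻¹ x y ⟩
    x⁻¹ * (x * y)  ≈⟨ *-congˡ xy≈0 ⟩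
    x⁻¹ * 0#       ≈⟨ zeroʳ x⁻¹ ⟩
    0#             ∎)

  x≉y⇒x-y≉0 : ∀ {x y} → ¬ x ≈ y → ¬ x - y ≈ 0#
  x≉y⇒x-y≉0 x≉y x-y≈0 = x≉y (x∙y⁻¹≈ε⇒x≈y _ _ x-y≈0)

  -1≉0 : ¬ - 1# ≈ 0#
  -1≉0 -1≈0 = 0≉1 (sym (begin
    1#      ≈⟨ -‿involutive 1# ⟨
    - - 1#  ≈⟨ -‿cong -1≈0 ⟩
    - 0#    ≈⟨ -0#≈0# ⟩
    0#      ∎))

  -x-y≉0 : ∀ {x y} → ¬ x ≈ 0# → y ≈ 0# → ¬ - x - y ≈ 0#
  -x-y≉0 {x} {y} x≉0 y≈0 -x-y≈0 = x≉0 (begin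
    x                ≈⟨ solve 2 (λ x y → x := :- (:- x :- y) :- y) refl x y ⟩
    - (- x - y) - y  ≈⟨ +-cong (-‿cong -x-y≈0) (-‿cong y≈0) ⟩
    - 0# - 0#        ≈⟨ solve 0 (:- :0 :- :0 := :0) refl ⟩
    0#               ∎)

  [x-x]*y≈0 : ∀ x y → (x - x) * y ≈ 0#
  [x-x]*y≈0 x y = trans (*-congʳ (-‿inverseʳ x)) (zeroˡ y)

  z*[[x-x]*y]≈0 : ∀ z x y → z * ((x - x) * y) ≈ 0#
  z*[[x-x]*y]≈0 z x y = trans (*-congˡ ([x-x]*y≈0 x y)) (zeroʳ z)

module ThreeSpace {c ℓ : Level} (R : CommutativeRing c ℓ) where
  open CommutativeRing R hiding (zero)
  open Linear R
  open IntegerCoefficients R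

  ⟨_,_,_⟩ : Carrier → Carrier → Carrier → Vec3
  ⟨ x , y , z ⟩ zero             = x
  ⟨ x , y , z ⟩ (suc zero)       = y
  ⟨ x , y , z ⟩ (suc (suc zero)) = z

  e₁ e₂ e₃ : Vec3
  e₁ = ⟨ 1# , 0# , 0# ⟩
  e₂ = ⟨ 0# , 1# , 0# ⟩
  e₃ = ⟨ 0# , 0# , 1# ⟩

  sum3-*e₁ : ∀ (u : Vec3) → sum3 (λ k → u k * e₁ k) ≈ u zero
  sum3-*e₁ u = solve 3 (λ x y z → x :* :1 :+ (y :* :0 :+ z :* :0) := x) refl
    (u zero) (u (suc zero)) (u (suc (suc zero)))

  sum3-*e₂ : ∀ (u : Vec3) → sum3 (λ k → u k * e₂ k) ≈ u (suc zero)
  sum3-*e₂ u = solve 3 (λ x y z → x :* :0 :+ (y :* :1 :+ z :* :0) := y) refl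
    (u zero) (u (suc zero)) (u (suc (suc zero)))

  sum3-*e₃ : ∀ (u : Vec3) → sum3 (λ k → u k * e₃ k) ≈ u (suc (suc zero))
  sum3-*e₃ u = solve 3 (λ x y z → x :* :0 :+ (y :* :0 :+ z :* :1) := z) refl
    (u zero) (u (suc zero)) (u (suc (suc zero)))

  ·-identityʳ : ∀ M → (M · I₃) ≈M M
  ·-identityʳ M i zero             = sum3-*e₁ (M i)
  ·-identityʳ M i (suc zero)       = sum3-*e₂ (M i)
  ·-identityʳ M i (suc (suc zero)) = sum3-*e₃ (M i)

  ⊛-congʳ : ∀ {M N} → M ≈M N → ∀ v → (M ⊛ v) ≈V (N ⊛ v)
  ⊛-congʳ M≈N v i = +-cong (*-congʳ (M≈N i zero))
    (+-cong (*-congʳ (M≈N i (suc zero))) (*-congʳ (M≈N i (suc (suc zero)))))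

  nonzero-coordinate : Decidable _≈_ → ∀ {v} → ¬ v ≈V 0V →
    ¬ v zero ≈ 0# ⊎ ¬ v (suc zero) ≈ 0# ⊎ ¬ v (suc (suc zero)) ≈ 0#
  nonzero-coordinate _≟_ {v} v≉0 with v zero ≟ 0# | v (suc zero) ≟ 0# | v (suc (suc zero)) ≟ 0#
  ... | no x≉0  | _       | _       = inj₁ x≉0
  ... | yes _   | no y≉0  | _       = inj₂ (inj₁ y≉0)
  ... | yes _   | yes _   | no z≉0  = inj₂ (inj₂ z≉0)
  ... | yes x≈0 | yes y≈0 | yes z≈0 =
    ⊥-elim (v≉0 λ { zero → x≈0 ; (suc zero) → y≈0 ; (suc (suc zero)) → z≈0 })

module SubspaceProperties {c ℓ w : Level} (F : CommutativeRing c ℓ) (isField : IsField F)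
  (W : Linear.Vec3 F → Set w) (W-subspace : Linear.IsSubspace F W) where
  open CommutativeRing F hiding (zero)
  open IsField isField using (inverse)
  open Linear F
  open ThreeSpace F
  open IsSubspace W-subspace

  W-coords : ∀ {u x y z} → W u →
    u zero ≈ x → u (suc zero) ≈ y → u (suc (suc zero)) ≈ z → W ⟨ x , y , z ⟩
  W-coords Wu x≈ y≈ z≈ =
    resp (λ { zero → x≈ ; (suc zero) → y≈ ; (suc (suc zero)) → z≈ }) Wu

  e₁∈ : ∀ {x y z} → W ⟨ x , y , z ⟩ → ¬ x ≈ 0# → y ≈ 0# → z ≈ 0# → W e₁
  e₁∈ {x} Wv x≉0 y≈0 z≈0 with inverse x x≉0
  ... | x⁻¹ , xx⁻¹≈1 = W-coords (*∈ x⁻¹ Wv)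
    (trans (*-comm _ _) xx⁻¹≈1)
    (trans (*-congˡ y≈0) (zeroʳ _))
    (trans (*-congˡ z≈0) (zeroʳ _))

  e₂∈ : ∀ {x y z} → W ⟨ x , y , z ⟩ → x ≈ 0# → ¬ y ≈ 0# → z ≈ 0# → W e₂
  e₂∈ {y = y} Wv x≈0 y≉0 z≈0 with inverse y y≉0
  ... | y⁻¹ , yy⁻¹≈1 = W-coords (*∈ y⁻¹ Wv)
    (trans (*-congˡ x≈0) (zeroʳ _))
    (trans (*-comm _ _) yy⁻¹≈1)
    (trans (*-congˡ z≈0) (zeroʳ _))

  e₃∈ : ∀ {x y z} → W ⟨ x , y , z ⟩ → x ≈ 0# → y ≈ 0# → ¬ z ≈ 0# → W e₃
  e₃∈ {z = z} Wv x≈0 y≈0 z≉0 with inverse z z≉0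
  ... | z⁻¹ , zz⁻¹≈1 = W-coords (*∈ z⁻¹ Wv)
    (trans (*-congˡ x≈0) (zeroʳ _))
    (trans (*-congˡ y≈0) (zeroʳ _))
    (trans (*-comm _ _) zz⁻¹≈1)

  basis∈⇒all : W e₁ → W e₂ → W e₃ → ∀ u → W u
  basis∈⇒all We₁ We₂ We₃ u = resp expansion≈u
    (+∈ (*∈ (u zero) We₁) (+∈ (*∈ (u (suc zero)) We₂) (*∈ (u (suc (suc zero))) We₃)))
    where
    expansion≈u :
      (λ i → u zero * e₁ i + (u (suc zero) * e₂ i + u (suc (suc zero)) * e₃ i)) ≈V u
    expansion≈u zero             = sum3-*e₁ u
    expansion≈u (suc zero)       = sum3-*e₂ u
    expansion≈u (suc (suc zero)) = sum3-*e₃ u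

module Ω₃ {c ℓ : Level} (F : CommutativeRing c ℓ) (isField : IsField F) where
  open CommutativeRing F hiding (zero; setoid)
  open FieldProperties F isField
  open ThreeSpace F
  open Linear F
  open IntegerCoefficients F
  open SetoidReasoning (CommutativeRing.setoid F)

  module _ (_≟_ : Decidable _≈_) (2≉0 : ¬ 1# + 1# ≈ 0#)
    (ξ η : Carrier) (ξη≈1 : ξ * η ≈ 1#) (ξ²≉1 : ¬ ξ * ξ ≈ 1#) where

    -- ΩB ξ η is the diagonal matrix with entries a, 1, b.
    a b : Carrier
    a = η * η
    b = ξ * ξ

    a≉1 : ¬ a ≈ 1#
    a≉1 η²≈1 = ξ²≉1 (begin
      ξ * ξ            ≈⟨ *-identityʳ _ ⟨
      ξ * ξ * 1#       ≈⟨ *-congˡ η²≈1 ⟨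
      ξ * ξ * (η * η)  ≈⟨ solve 2 (λ x y → x :* x :* (y :* y) := x :* y :* (x :* y)) refl _ _ ⟩
      ξ * η * (ξ * η)  ≈⟨ *-cong ξη≈1 ξη≈1 ⟩
      1# * 1#          ≈⟨ *-identityʳ _ ⟩
      1#               ∎)

    [b-a]*t≈0 : a ≈ b → ∀ t → (b - a) * t ≈ 0#
    [b-a]*t≈0 a≈b t = trans (*-congʳ (+-congʳ (sym a≈b))) ([x-x]*y≈0 a t)

    module InvariantSubspace {w : Level} (W : Vec3 → Set w) (W-subspace : IsSubspace W)
      (W-invariant : ∀ g v → Generated ΩA (ΩB ξ η) g → W v → W (g ⊛ v)) where
      open IsSubspace W-subspace
      open SubspaceProperties F isField W W-subspace

      generator-closed : ∀ M {v} → Generated ΩA (ΩB ξ η) (M · I₃) → W v → W (M ⊛ v)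
      generator-closed M {v} gen Wv = resp (⊛-congʳ (·-identityʳ M) v) (W-invariant _ v gen Wv)

      ΩA-closed : ∀ {x y z} → W ⟨ x , y , z ⟩ →
        W ⟨ x + (1# + 1#) * y - z , - x - y , - x ⟩
      ΩA-closed {x} {y} {z} Wv = W-coords (generator-closed ΩA (gen-A gen-id) Wv)
        (solve 3 (λ x y z → :1 :* x :+ (:2 :* y :+ (:- :1) :* z) := x :+ :2 :* y :- z) refl x y z)
        (solve 3 (λ x y z → (:- :1) :* x :+ ((:- :1) :* y :+ :0 :* z) := :- x :- y) refl x y z)
        (solve 3 (λ x y z → (:- :1) :* x :+ (:0 :* y :+ :0 :* z) := :- x) refl x y z)

      ΩB-closed : ∀ {x y z} → W ⟨ x , y , z ⟩ → W ⟨ a * x , y , b * z ⟩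
      ΩB-closed {x} {y} {z} Wv = W-coords (generator-closed (ΩB ξ η) (gen-B gen-id) Wv)
        (solve 4 (λ a x y z → a :* x :+ (:0 :* y :+ :0 :* z) := a :* x) refl a x y z)
        (solve 3 (λ x y z → :0 :* x :+ (:1 :* y :+ :0 :* z) := y) refl x y z)
        (solve 4 (λ b x y z → :0 :* x :+ (:0 :* y :+ b :* z) := b :* z) refl b x y z)

      ΩB-shift-closed : ∀ t {x y z} → W ⟨ x , y , z ⟩ →
        W ⟨ (a - t) * x , (1# - t) * y , (b - t) * z ⟩
      ΩB-shift-closed t {x} {y} {z} Wv = W-coords (+∈ (ΩB-closed Wv) (*∈ (- t) Wv))
        (solve 3 (λ a t x → a :* x :+ (:- t) :* x := (a :- t) :* x) refl a t x)
        (solve 2 (λ t y → y :+ (:- t) :* y := (:1 :- t) :* y) refl t y)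
        (solve 3 (λ b t z → b :* z :+ (:- t) :* z := (b :- t) :* z) refl b t z)

      e₁∈⇒e₃∈ : W e₁ → W e₃
      e₁∈⇒e₃∈ We₁ = e₃∈ (ΩA-closed (ΩA-closed We₁))
        (solve 0 ((:1 :+ :2 :* :0 :- :0) :+ :2 :* (:- :1 :- :0) :- :- :1 := :0) refl)
        (solve 0 (:- (:1 :+ :2 :* :0 :- :0) :- (:- :1 :- :0) := :0) refl)
        (λ h → -1≉0 (trans (solve 0 (:- :1 := :- (:1 :+ :2 :* :0 :- :0)) refl) h))

      e₁∈⇒e₂∈ : W e₁ → W e₂
      e₁∈⇒e₂∈ We₁ =
        W-coords
          (+∈ We₁ (+∈ (*∈ (- 1#) (ΩA-closed We₁)) (*∈ (- 1#) (e₁∈⇒e₃∈ We₁))))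
        (solve 0 (:1 :+ ((:- :1) :* (:1 :+ :2 :* :0 :- :0) :+ (:- :1) :* :0) := :0) refl)
        (solve 0 (:0 :+ ((:- :1) :* (:- :1 :- :0) :+ (:- :1) :* :0) := :1) refl)
        (solve 0 (:0 :+ ((:- :1) :* (:- :1) :+ (:- :1) :* :1) := :0) refl)

      e₂∈⇒e₁∈ : W e₂ → W e₁
      e₂∈⇒e₁∈ We₂ = e₁∈ (W-coords (+∈ (ΩA-closed We₂) We₂)
          (solve 0 (:0 :+ :2 :* :1 :- :0 :+ :0 := :2) refl)
          (solve 0 (:- :0 :- :1 :+ :1 := :0) refl)
          (solve 0 (:- :0 :+ :0 := :0) refl))
        2≉0 refl refl

      e₃∈⇒e₁∈ : W e₃ → W e₁
      e₃∈⇒e₁∈ We₃ = e₁∈ (ΩA-closed We₃)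
        (λ h → -1≉0 (trans (solve 0 (:- :1 := :0 :+ :2 :* :0 :- :1) refl) h))
        (solve 0 (:- :0 :- :0 := :0) refl)
        (solve 0 (:- :0 := :0) refl)

      -- (ΩB − s)(ΩB − t) kills the coordinates whose eigenvalue is s or t.
      e₁∈-if-a≉b : ¬ a ≈ b → ∀ {x y z} → W ⟨ x , y , z ⟩ →
        ¬ x ≈ 0# ⊎ ¬ y ≈ 0# ⊎ ¬ z ≈ 0# → W e₁
      e₁∈-if-a≉b a≉b {x} {y} {z} Wv (inj₁ x≉0) =
        e₁∈ (ΩB-shift-closed 1# (ΩB-shift-closed b Wv))
          (*-nonzero (x≉y⇒x-y≉0 a≉1) (*-nonzero (x≉y⇒x-y≉0 a≉b) x≉0))
          ([x-x]*y≈0 1# _)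
          (z*[[x-x]*y]≈0 _ b z)
      e₁∈-if-a≉b a≉b {x} {y} {z} Wv (inj₂ (inj₁ y≉0)) = e₂∈⇒e₁∈
        (e₂∈ (ΩB-shift-closed a (ΩB-shift-closed b Wv))
          ([x-x]*y≈0 a _)
          (*-nonzero (x≉y⇒x-y≉0 (a≉1 ∘ sym))
            (*-nonzero (x≉y⇒x-y≉0 (ξ²≉1 ∘ sym)) y≉0))
          (z*[[x-x]*y]≈0 _ b z))
      e₁∈-if-a≉b a≉b {x} {y} {z} Wv (inj₂ (inj₂ z≉0)) = e₃∈⇒e₁∈
        (e₃∈ (ΩB-shift-closed 1# (ΩB-shift-closed a Wv))
          (z*[[x-x]*y]≈0 _ a x)
          ([x-x]*y≈0 1# _)
          (*-nonzero (x≉y⇒x-y≉0 ξ²≉1) (*-nonzero (x≉y⇒x-y≉0 (a≉b ∘ sym)) z≉0)))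

      -- Only the middle eigenvalue can be isolated; ΩA turns a vector
      -- ⟨ x , 0 , z ⟩ with x ≉ 0 into one with middle coordinate − x.
      e₁∈-if-a≈b : a ≈ b → ∀ {x y z} → W ⟨ x , y , z ⟩ →
        ¬ x ≈ 0# ⊎ ¬ y ≈ 0# ⊎ ¬ z ≈ 0# → W e₁
      e₁∈-if-a≈b a≈b {x} {y} {z} Wv nonzero with y ≟ 0# | x ≟ 0# | nonzero
      ... | no y≉0 | _ | _ = e₂∈⇒e₁∈
        (e₂∈ (ΩB-shift-closed a Wv)
          ([x-x]*y≈0 a x)
          (*-nonzero (x≉y⇒x-y≉0 (a≉1 ∘ sym)) y≉0)
          ([b-a]*t≈0 a≈b z))
      ... | yes y≈0 | no x≉0 | _ = e₂∈⇒e₁∈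
        (e₂∈ (ΩB-shift-closed a (ΩA-closed Wv))
          ([x-x]*y≈0 a _)
          (*-nonzero (x≉y⇒x-y≉0 (a≉1 ∘ sym)) (-x-y≉0 x≉0 y≈0))
          ([b-a]*t≈0 a≈b (- x)))
      ... | yes y≈0 | yes x≈0 | inj₁ x≉0        = ⊥-elim (x≉0 x≈0)
      ... | yes y≈0 | yes x≈0 | inj₂ (inj₁ y≉0) = ⊥-elim (y≉0 y≈0)
      ... | yes y≈0 | yes x≈0 | inj₂ (inj₂ z≉0) = e₃∈⇒e₁∈ (e₃∈ Wv x≈0 y≈0 z≉0)

      nonzero∈⇒e₁∈ : ∀ v → W v → ¬ v ≈V 0V → W e₁
      nonzero∈⇒e₁∈ v Wv v≉0 with a ≟ b
      ... | yes a≈b = e₁∈-if-a≈b a≈b Wxyz (nonzero-coordinate _≟_ v≉0)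
        where Wxyz = W-coords Wv refl refl refl
      ... | no a≉b  = e₁∈-if-a≉b a≉b Wxyz (nonzero-coordinate _≟_ v≉0)
        where Wxyz = W-coords Wv refl refl refl

    irreducible : ActsIrreducibly (Generated ΩA (ΩB ξ η))
    irreducible W W-subspace W-invariant v Wv v≉0 =
      basis∈⇒all We₁ (e₁∈⇒e₂∈ We₁) (e₁∈⇒e₃∈ We₁)
      where
      open InvariantSubspace W W-subspace W-invariant
      open SubspaceProperties F isField W W-subspace
      We₁ : W e₁
      We₁ = nonzero∈⇒e₁∈ v Wv v≉0

proposition4p4 : ∀ {c ℓ : Level} (p k : ℕ) → Prime p → 5 ≤ p → 1 ≤ k →
    (F : CommutativeRing c ℓ) → IsField F →
    Inverse (CommutativeRing.setoid F) (setoid (Fin (p ^ k))) →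
    let open CommutativeRing F in
    let open Linear F in
    (ξ η : Carrier) → IsGenerator ξ → ξ * η ≈ 1# →
    ActsIrreducibly (Generated ΩA (ΩB ξ η))
proposition4p4 p k p-prime 5≤p 1≤k F isField I ξ η ξ-generator ξη≈1 =
  Ω₃.irreducible F isField _≟_ 2≉0 ξ η ξη≈1 (generator²≉1 4≤pᵏ ξ ξ-generator)
  where
  open CommutativeRing F using (_≈_; _+_; 0#; 1#)
  open FiniteField F I using (_≟_; 1+1≈0⇒even; generator²≉1)

  1≤p : 1 ≤ p
  1≤p = ℕ.≤-trans (s≤s z≤n) 5≤p

  3≤p : 3 ≤ p
  3≤p = ℕ.≤-trans (s≤s (s≤s (s≤s z≤n))) 5≤p

  4≤pᵏ : 4 ≤ p ^ k
  4≤pᵏ = ℕ.≤-trans (ℕ.n≤1+n 4) (ℕ.≤-trans 5≤p (m≤m^n p k 1≤p 1≤k))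

  2∤pᵏ : ¬ 2 ∣ p ^ k
  2∤pᵏ = prime∤⇒prime∤^ prime[2] (2∤odd-prime p-prime 3≤p) k

  2≉0 : ¬ 1# + 1# ≈ 0#
  2≉0 = 2∤pᵏ ∘ 1+1≈0⇒even (IsField.0≉1 isField)
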